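{- Let $d\geq 3$ be an integer and let $\mathcal{F}(d)$ be the family of graphs described in the context. Then (1) every graph in $\mathcal{F}(d)$ is irregular (not regular); and (2) $\min\{C(F)\mid F\in\mathcal{F}(d)\}\geq d-1$.
   Context: All graphs are finite and simple. For a graph $F$, $C(F)$ denotes the maximum number of common neighbors of two distinct vertices of $F$. For an integer $d\geq 3$, the family $\mathcal{F}(d)$ consists of all graphs of the following five types $\Gamma_1(d,l),\dots,\Gamma_5(d,l)$, where $l\geq d+1$ for types 1--4 and $l\geq d+2$ for type 5; in each type, $C$ denotes an independent set of $l$ vertices, and the "arbitrary" graphs may be any graphs (spanning subgraphs of complete graphs) on the indicated vertex sets. (Type 1) $\Gamma_1(d,l)$: vertex set $A\cup C$ with $|A|=d$; the edges are those of an arbitrary graph on $A$ together with all edges between $A$ and $C$ (i.e. $H_d\vee\overline{K}_l$). (Type 2) $\Gamma_2(d,l)$: vertex set $A\cup B\cup C$ with $|A|=d-1$, $B=\{b_1,b_2\}$; the edges are: an arbitrary graph on $A$, the edge $b_1b_2$, an arbitrary set of edges between $A$ and $B$, all edges between $A$ and $C$, and for each vertex of $C$ exactly one edge to a vertex of $B$. (Type 3) $\Gamma_3(d,l)$: vertex set $A\cup B\cup B'\cup C$ with $|A|=d-2$, $|B|=|B'|=2$; the edges are: an arbitrary graph on $A\cup B\cup B'$, all edges between $A$ and $C$, and for each vertex of $C$ exactly one edge to a vertex of $B$ and exactly one edge to a vertex of $B'$. (Type 4) $\Gamma_4(d,l)$: obtained from a graph $\Gamma_1(d,l)$ (with parts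 $A$, $C$) by choosing two vertices $u_1,u_2\in C$, adding the edge $u_1u_2$, and deleting a set $E_0$ of edges between $A$ and $\{u_1,u_2\}$ such that $E_0$ contains at most one edge incident with $u_1$ and at most one edge incident with $u_2$. (Type 5) $\Gamma_5(d,l)$: vertex set $A\cup C$ with $|A|=d+1$; the edges are an arbitrary graph on $A$ together with edges between $A$ and $C$ such that each vertex of $C$ is adjacent to either $d$ or $d+1$ vertices of $A$. -}

module Defs where

open import Data.Nat using (ℕ; zero; suc; _+_; _∸_; _≤_; _⊔_)
open import Data.Fin using (Fin; zero; suc; _≟_)
open import Data.Bool using (Bool; true; false; if_then_else_; _∧_; _∨_; not)
open import Data.Product using (Σ; ∃; _×_; _,_)
open import Data.Sum using (_⊎_)
open import Relation.Nullary using (¬_; does)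
open import Relation.Binary.PropositionalEquality using (_≡_; _≢_)

record Graph : Set where
  field
    n          : ℕ
    adj        : Fin n → Fin n → Bool
    adj-sym    : ∀ u v → adj u v ≡ adj v u
    adj-irrefl : ∀ v → adj v v ≡ false
open Graph public

sumFin : ∀ {n} → (Fin n → ℕ) → ℕ
sumFin {zero}  f = 0
sumFin {suc n} f = f zero + sumFin (λ i → f (suc i))

maxFin : ∀ {n} → (Fin n → ℕ) → ℕ
maxFin {zero}  f = 0
maxFin {suc n} f = f zero ⊔ maxFin (λ i → f (suc i))

count : ∀ {n} → (Fin n → Bool) → ℕ
count p = sumFin (λ i → if p i then 1 else 0)

deg : (G : Graph) → Fin (n G) → ℕ
deg G v = count (adj G v)

commonNbrs : (G : Graph) → Fin (n G) → Fin (n G) → ℕ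
commonNbrs G u v = count (λ w → adj G u w ∧ adj G v w)

-- C(F): maximum number of common neighbours of two distinct vertices
-- (pairs u = v contribute 0, which is harmless since all values are ≥ 0).
Cmax : Graph → ℕ
Cmax G = maxFin (λ u → maxFin (λ v → if does (u ≟ v) then 0 else commonNbrs G u v))

Regular : Graph → Set
Regular G = ∃ λ k → ∀ v → deg G v ≡ k

-- Type 1 : H_d ∨ \bar K_l.  inA v = true iff v ∈ A, otherwise v ∈ C.
IsΓ₁ : ℕ → ℕ → Graph → Set
IsΓ₁ d l G = Σ (Fin (n G) → Bool) λ inA →
    count inA ≡ d
  × count (λ v → not (inA v)) ≡ l
  × (∀ u v → inA u ≡ false → inA v ≡ false → adj G u v ≡ false)
  × (∀ u v → inA u ≡ true → inA v ≡ false → adj G u v ≡ true)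

data P₂ : Set where
  a₂ b₂ c₂ : P₂

isA₂ isB₂ isC₂ : P₂ → Bool
isA₂ a₂ = true
isA₂ _  = false
isB₂ b₂ = true
isB₂ _  = false
isC₂ c₂ = true
isC₂ _  = false

IsΓ₂ : ℕ → ℕ → Graph → Set
IsΓ₂ d l G = Σ (Fin (n G) → P₂) λ lab →
    count (λ v → isA₂ (lab v)) ≡ d ∸ 1
  × count (λ v → isB₂ (lab v)) ≡ 2
  × count (λ v → isC₂ (lab v)) ≡ l
  × (∀ u v → lab u ≡ b₂ → lab v ≡ b₂ → u ≢ v → adj G u v ≡ true)
  × (∀ u v → lab u ≡ a₂ → lab v ≡ c₂ → adj G u v ≡ true)
  × (∀ u v → lab u ≡ c₂ → lab v ≡ c₂ → adj G u v ≡ false)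
  × (∀ c → lab c ≡ c₂ → count (λ w → isB₂ (lab w) ∧ adj G c w) ≡ 1)

data P₃ : Set where
  a₃ b₃ b'₃ c₃ : P₃

isA₃ isB₃ isB'₃ isC₃ : P₃ → Bool
isA₃ a₃ = true
isA₃ _  = false
isB₃ b₃ = true
isB₃ _  = false
isB'₃ b'₃ = true
isB'₃ _   = false
isC₃ c₃ = true
isC₃ _  = false

IsΓ₃ : ℕ → ℕ → Graph → Set
IsΓ₃ d l G = Σ (Fin (n G) → P₃) λ lab →
    count (λ v → isA₃ (lab v)) ≡ d ∸ 2
  × count (λ v → isB₃ (lab v)) ≡ 2
  × count (λ v → isB'₃ (lab v)) ≡ 2
  × count (λ v → isC₃ (lab v)) ≡ l
  × (∀ u v → lab u ≡ a₃ → lab v ≡ c₃ → adj G u v ≡ true)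
  × (∀ u v → lab u ≡ c₃ → lab v ≡ c₃ → adj G u v ≡ false)
  × (∀ c → lab c ≡ c₃ → count (λ w → isB₃ (lab w) ∧ adj G c w) ≡ 1)
  × (∀ c → lab c ≡ c₃ → count (λ w → isB'₃ (lab w) ∧ adj G c w) ≡ 1)

-- Type 4 : labels A, C∖{u₁,u₂}, U = {u₁,u₂}; the original C is C∖U ∪ U.
data P₄ : Set where
  a₄ c₄ u₄ : P₄

isA₄ isC₄ isU₄ isCU₄ : P₄ → Bool
isA₄ a₄ = true
isA₄ _  = false
isC₄ c₄ = true
isC₄ _  = false
isU₄ u₄ = true
isU₄ _  = false
isCU₄ a₄ = false
isCU₄ _  = true

IsΓ₄ : ℕ → ℕ → Graph → Set
IsΓ₄ d l G = Σ (Fin (n G) → P₄) λ lab →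
    count (λ v → isA₄ (lab v)) ≡ d
  × count (λ v → isCU₄ (lab v)) ≡ l
  × count (λ v → isU₄ (lab v)) ≡ 2
  × (∀ u v → lab u ≡ u₄ → lab v ≡ u₄ → u ≢ v → adj G u v ≡ true)
  × (∀ u v → lab u ≡ c₄ → isCU₄ (lab v) ≡ true → adj G u v ≡ false)
  × (∀ u v → lab u ≡ a₄ → lab v ≡ c₄ → adj G u v ≡ true)
  × (∀ u → lab u ≡ u₄ → count (λ w → isA₄ (lab w) ∧ not (adj G u w)) ≤ 1)

IsΓ₅ : ℕ → ℕ → Graph → Set
IsΓ₅ d l G = Σ (Fin (n G) → Bool) λ inA →
    count inA ≡ suc d
  × count (λ v → not (inA v)) ≡ l
  × (∀ u v → inA u ≡ false → inA v ≡ false → adj G u v ≡ false)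
  × (∀ c → inA c ≡ false →
       (count (λ w → inA w ∧ adj G c w) ≡ d) ⊎ (count (λ w → inA w ∧ adj G c w) ≡ suc d))

-- The family 𝓕(d) (up to isomorphism, via vertex labellings)
InF : ℕ → Graph → Set
InF d G = ∃ λ l →
    (suc d ≤ l × IsΓ₁ d l G)
  ⊎ (suc d ≤ l × IsΓ₂ d l G)
  ⊎ (suc d ≤ l × IsΓ₃ d l G)
  ⊎ (suc d ≤ l × IsΓ₄ d l G)
  ⊎ (suc (suc d) ≤ l × IsΓ₅ d l G)

-- In each of the types Γ₁–Γ₄ some vertex c of the
-- independent set C has all its neighbours in a set of size at most d,
-- while some vertex a ∈ A is adjacent to all l ≥ d + 1 vertices of C;
-- so deg c < deg a.  (For Γ₄ the vertex a is found by double counting the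
-- at most two deleted A–U edges.)  For Γ₅ the double count of the A–C
-- edges gives l·k ≤ (d + 1)·k in a k-regular graph, contradicting l ≥ d + 2.
--
-- Two vertices joined to the same set S share |S|
-- neighbours; this handles Γ₁, Γ₂, Γ₄ and Γ₃ with d ≥ 4.  For Γ₃ with
-- d = 3 each vertex of C has one neighbour in B, so double counting
-- gives a b ∈ B sharing ≥ l/2 ≥ 2 neighbours with the vertex of A; for
-- Γ₅ two vertices of C each miss at most one vertex of A.
module Submission where

open import Defs
open import Data.Nat using (ℕ; _≤_; _∸_)
open import Data.Product using (_×_)
open import Relation.Nullary using (¬_)

open import Data.Nat using (zero; suc; _+_; _*_; _<_; z≤n; s≤s; s≤s⁻¹; >-nonZero)
open import Data.Nat.Properties
  using (≤-refl; ≤-reflexive; ≤-trans; <-irrefl; n≤1+n; m≤n+m; m≤m⊔n; m≤n⊔m;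
         +-mono-≤; +-monoˡ-≤; +-monoʳ-≤; +-cancelˡ-≤; +-comm;
         *-cancelʳ-≤; m∸n≤m; ∸-monoˡ-≤; m+n∸n≡m; m∸n+n≡m; m+n≡0⇒n≡0;
         *-cancelˡ-≤; +-0-commutativeMonoid; module ≤-Reasoning)
open import Data.Fin using (Fin; zero; suc; _≟_)
open import Data.Fin.Properties using () renaming (suc-injective to Fin-suc-injective)
open import Data.Bool using (Bool; true; false; if_then_else_; _∧_; _∨_; not)
open import Data.Bool.Properties using (∧-conicalˡ; ∧-conicalʳ; not-injective)
open import Data.Product using (Σ-syntax; ∃-syntax; _,_; proj₁; proj₂; map)
open import Data.Sum using (inj₁; inj₂)
open import Function using (_∘_; id)
open import Relation.Nullary using (yes; no; does)
open import Relation.Binary.PropositionalEquality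
  using (_≡_; _≢_; refl; sym; trans; cong; cong₂; module ≡-Reasoning)
open import Algebra.Properties.CommutativeMonoid.Sum +-0-commutativeMonoid
  using (sum; ∑-comm; ∑-distrib-+; sum-cong-≗; sum-replicate-zero)

-- sumFin agrees with the library's monoid sum, whose algebra we reuse.
sumFin≡sum : ∀ {m} (f : Fin m → ℕ) → sumFin f ≡ sum f
sumFin≡sum {zero}  f = refl
sumFin≡sum {suc m} f = cong (f zero +_) (sumFin≡sum (f ∘ suc))

sumFin-zero : ∀ m → sumFin {m} (λ _ → 0) ≡ 0
sumFin-zero m = trans (sumFin≡sum {m} (λ _ → 0)) (sum-replicate-zero m)

sumFin-+ : ∀ {m} (f g : Fin m → ℕ) → sumFin (λ i → f i + g i) ≡ sumFin f + sumFin g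
sumFin-+ f g = begin
  sumFin (λ i → f i + g i)  ≡⟨ sumFin≡sum (λ i → f i + g i) ⟩
  sum (λ i → f i + g i)     ≡⟨ ∑-distrib-+ f g ⟩
  sum f + sum g             ≡⟨ sym (cong₂ _+_ (sumFin≡sum f) (sumFin≡sum g)) ⟩
  sumFin f + sumFin g       ∎
  where open ≡-Reasoning

sumFin-comm : ∀ {m m'} (f : Fin m → Fin m' → ℕ) →
  sumFin (λ i → sumFin (f i)) ≡ sumFin (λ j → sumFin (λ i → f i j))
sumFin-comm f = begin
  sumFin (λ i → sumFin (f i))          ≡⟨ sumFin≡sum (λ i → sumFin (f i)) ⟩
  sum (λ i → sumFin (f i))             ≡⟨ sum-cong-≗ (λ i → sumFin≡sum (f i)) ⟩
  sum (λ i → sum (f i))                ≡⟨ ∑-comm f ⟩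
  sum (λ j → sum (λ i → f i j))        ≡⟨ sum-cong-≗ (λ j → sym (sumFin≡sum (λ i → f i j))) ⟩
  sum (λ j → sumFin (λ i → f i j))     ≡⟨ sym (sumFin≡sum (λ j → sumFin (λ i → f i j))) ⟩
  sumFin (λ j → sumFin (λ i → f i j))  ∎
  where open ≡-Reasoning

sumFin-cong : ∀ {m} {f g : Fin m → ℕ} → (∀ i → f i ≡ g i) → sumFin f ≡ sumFin g
sumFin-cong {zero}  h = refl
sumFin-cong {suc m} h = cong₂ _+_ (h zero) (sumFin-cong (h ∘ suc))

sumFin-mono : ∀ {m} {f g : Fin m → ℕ} → (∀ i → f i ≤ g i) → sumFin f ≤ sumFin g
sumFin-mono {zero}  h = z≤n
sumFin-mono {suc m} h = +-mono-≤ (h zero) (sumFin-mono (h ∘ suc))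

-- Σ_{v ∈ P} f v, the sum of f over the vertices satisfying P.
-- Note that count P is, by definition, sumOver P (λ _ → 1).
sumOver : ∀ {m} → (Fin m → Bool) → (Fin m → ℕ) → ℕ
sumOver P f = sumFin (λ v → if P v then f v else 0)

sumOver-mono : ∀ {m} (P : Fin m → Bool) {f g : Fin m → ℕ} →
  (∀ v → P v ≡ true → f v ≤ g v) → sumOver P f ≤ sumOver P g
sumOver-mono P h = sumFin-mono (λ v → restrict (P v) (h v))
  where
  restrict : ∀ b {x y} → (b ≡ true → x ≤ y) → (if b then x else 0) ≤ (if b then y else 0)
  restrict true  h = h refl
  restrict false h = z≤n

sumOver-const : ∀ {m} (P : Fin m → Bool) k → sumOver P (λ _ → k) ≡ count P * k
sumOver-const {zero}  P k = refl
sumOver-const {suc m} P k with P zero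
... | true  = cong (k +_) (sumOver-const (P ∘ suc) k)
... | false = sumOver-const (P ∘ suc) k

sumOver-≤ : ∀ {m} (P : Fin m → Bool) (f : Fin m → ℕ) k →
  (∀ v → P v ≡ true → f v ≤ k) → sumOver P f ≤ count P * k
sumOver-≤ P f k h = ≤-trans (sumOver-mono P h) (≤-reflexive (sumOver-const P k))

sumOver-≥ : ∀ {m} (P : Fin m → Bool) (f : Fin m → ℕ) k →
  (∀ v → P v ≡ true → k ≤ f v) → count P * k ≤ sumOver P f
sumOver-≥ P f k h = ≤-trans (≤-reflexive (sym (sumOver-const P k))) (sumOver-mono P h)

vanishing-term : ∀ {m} (P : Fin m → Bool) (f : Fin m → ℕ) →
  sumOver P f < count P → ∃[ v ] P v ≡ true × f v ≡ 0
vanishing-term {suc m} P f h with P zero in eP | f zero in ef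
... | true  | zero   = zero , eP , ef
... | true  | suc x  = map suc id (vanishing-term (P ∘ suc) (f ∘ suc)
                         (≤-trans (s≤s (m≤n+m _ x)) (s≤s⁻¹ h)))
... | false | _      = map suc id (vanishing-term (P ∘ suc) (f ∘ suc) h)

∧-intro : ∀ {a b} → a ≡ true → b ≡ true → a ∧ b ≡ true
∧-intro refl refl = refl

∧-not-false : ∀ {a b} → a ≡ true → a ∧ not b ≡ false → b ≡ true
∧-not-false {b = true}  refl _  = refl
∧-not-false {b = false} refl ()

count-mono : ∀ {m} {p q : Fin m → Bool} → (∀ w → p w ≡ true → q w ≡ true) → count p ≤ count q
count-mono {p = p} {q} h = sumFin-mono (λ w → indicator-mono (p w) (q w) (h w))
  where
  indicator-mono : ∀ a b → (a ≡ true → b ≡ true) → (if a then 1 else 0) ≤ (if b then 1 else 0)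
  indicator-mono false _     _ = z≤n
  indicator-mono true  true  _ = ≤-refl
  indicator-mono true  false h with h refl
  ... | ()

count-∨ : ∀ {m} (p q : Fin m → Bool) → count (λ w → p w ∨ q w) ≤ count p + count q
count-∨ p q = ≤-trans (sumFin-mono (λ w → indicator-∨ (p w) (q w)))
                      (≤-reflexive (sumFin-+ (λ w → if p w then 1 else 0) (λ w → if q w then 1 else 0)))
  where
  indicator-∨ : ∀ a b → (if a ∨ b then 1 else 0) ≤ (if a then 1 else 0) + (if b then 1 else 0)
  indicator-∨ true  _ = s≤s z≤n
  indicator-∨ false _ = ≤-refl

count-partition : ∀ {m} (p q : Fin m → Bool) →
  count p ≡ count (λ w → p w ∧ q w) + count (λ w → p w ∧ not (q w))
count-partition p q =
  trans (sumFin-cong (λ w → indicator-split (p w) (q w)))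
        (sumFin-+ (λ w → if p w ∧ q w then 1 else 0) (λ w → if p w ∧ not (q w) then 1 else 0))
  where
  indicator-split : ∀ a b →
    (if a then 1 else 0) ≡ (if a ∧ b then 1 else 0) + (if a ∧ not b then 1 else 0)
  indicator-split true  true  = refl
  indicator-split true  false = refl
  indicator-split false _     = refl

count-zero : ∀ {m} (p : Fin m → Bool) → count p ≡ 0 → ∀ w → p w ≡ false
count-zero p h zero    with p zero | h
... | true  | ()
... | false | _  = refl
count-zero p h (suc w) = count-zero (p ∘ suc) (m+n≡0⇒n≡0 (if p zero then 1 else 0) h) w

member : ∀ {m} (p : Fin m → Bool) → 1 ≤ count p → ∃[ i ] p i ≡ true
member {suc m} p h with p zero in e
... | true  = zero , e
... | false = map suc id (member (p ∘ suc) h)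

two-members : ∀ {m} (p : Fin m → Bool) → 2 ≤ count p →
  Σ[ i ∈ Fin m ] Σ[ j ∈ Fin m ] i ≢ j × p i ≡ true × p j ≡ true
two-members {suc m} p h with p zero in e
... | true  with member (p ∘ suc) (s≤s⁻¹ h)
...   | j , ej = zero , suc j , (λ ()) , e , ej
two-members {suc m} p h | false with two-members (p ∘ suc) h
...   | i , j , i≢j , ei , ej = suc i , suc j , i≢j ∘ Fin-suc-injective , ei , ej

double-count : ∀ {m} (P Q : Fin m → Bool) (R : Fin m → Fin m → Bool) →
  (∀ v w → R v w ≡ R w v) →
  sumOver P (λ v → count (λ w → Q w ∧ R v w)) ≡ sumOver Q (λ w → count (λ v → P v ∧ R w v))
double-count {m} P Q R R-sym = begin
  sumOver P (λ v → count (λ w → Q w ∧ R v w))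
    ≡⟨ sumFin-cong (λ v → restrict-count (P v) (λ w → Q w ∧ R v w)) ⟩
  sumFin (λ v → count (λ w → P v ∧ (Q w ∧ R v w)))
    ≡⟨ sumFin-comm (λ v w → if P v ∧ (Q w ∧ R v w) then 1 else 0) ⟩
  sumFin (λ w → count (λ v → P v ∧ (Q w ∧ R v w)))
    ≡⟨ sumFin-cong (λ w → sumFin-cong (λ v →
         cong (λ b → if b then 1 else 0) (flip (P v) (Q w) (R-sym v w)))) ⟩
  sumFin (λ w → count (λ v → Q w ∧ (P v ∧ R w v)))
    ≡⟨ sym (sumFin-cong (λ w → restrict-count (Q w) (λ v → P v ∧ R w v))) ⟩
  sumOver Q (λ w → count (λ v → P v ∧ R w v)) ∎
  where
  open ≡-Reasoning
  restrict-count : ∀ b (q : Fin m → Bool) → (if b then count q else 0) ≡ count (λ w → b ∧ q w)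
  restrict-count true  q = refl
  restrict-count false q = sym (sumFin-zero m)
  flip : ∀ a b {x y} → x ≡ y → a ∧ (b ∧ x) ≡ b ∧ (a ∧ y)
  flip true  true  e = e
  flip true  false _ = refl
  flip false true  _ = refl
  flip false false _ = refl

deg-≥ : (G : Graph) (S : Fin (n G) → Bool) (v : Fin (n G)) →
  (∀ w → S w ≡ true → adj G v w ≡ true) → count S ≤ deg G v
deg-≥ G S v = count-mono

deg-≤ : (G : Graph) (S : Fin (n G) → Bool) (v : Fin (n G)) →
  (∀ w → adj G v w ≡ true → S w ≡ true) → deg G v ≤ count S
deg-≤ G S v = count-mono

irregular : (G : Graph) (u v : Fin (n G)) → deg G u < deg G v → ¬ Regular G
irregular G u v lt (k , deg≡k) rewrite deg≡k u | deg≡k v = <-irrefl refl lt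

maxFin-≥ : ∀ {m} (f : Fin m → ℕ) i → f i ≤ maxFin f
maxFin-≥ f zero    = m≤m⊔n (f zero) _
maxFin-≥ f (suc i) = ≤-trans (maxFin-≥ (f ∘ suc) i) (m≤n⊔m (f zero) _)

commonNbrs-≤Cmax : (G : Graph) (u v : Fin (n G)) → u ≢ v → commonNbrs G u v ≤ Cmax G
commonNbrs-≤Cmax G u v u≢v = ≤-trans (≤-reflexive (entry (u ≟ v)))
  (≤-trans (maxFin-≥ (pairValue u) v) (maxFin-≥ (λ x → maxFin (pairValue x)) u))
  where
  pairValue : Fin (n G) → Fin (n G) → ℕ
  pairValue x y = if does (x ≟ y) then 0 else commonNbrs G x y
  entry : ∀ dec → commonNbrs G u v ≡ (if does dec then 0 else commonNbrs G u v)
  entry (yes u≡v) with u≢v u≡v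
  ... | ()
  entry (no _)    = refl

shared-≤Cmax : (G : Graph) (S : Fin (n G) → Bool) (u v : Fin (n G)) → u ≢ v →
  (∀ w → S w ≡ true → adj G u w ≡ true × adj G v w ≡ true) → count S ≤ Cmax G
shared-≤Cmax G S u v u≢v h =
  ≤-trans (count-mono (λ w Sw → ∧-intro (proj₁ (h w Sw)) (proj₂ (h w Sw))))
          (commonNbrs-≤Cmax G u v u≢v)

joined-irregular : (G : Graph) (P S : Fin (n G) → Bool) {k : ℕ} → 1 ≤ count P →
  (∀ u w → P u ≡ true → S w ≡ true → adj G u w ≡ true) →
  (∀ w → S w ≡ true → deg G w ≤ k) → k < count S → ¬ Regular G
joined-irregular G P S P≥1 joined small k<|S|
  with member P P≥1 | member S (≤-trans (s≤s z≤n) k<|S|)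
... | a , a∈P | c , c∈S =
  irregular G c a (≤-trans (s≤s (small c c∈S)) (≤-trans k<|S| (deg-≥ G S a (λ w → joined a w a∈P))))

joined-≤Cmax : (G : Graph) (P S : Fin (n G) → Bool) → 2 ≤ count P →
  (∀ u w → P u ≡ true → S w ≡ true → adj G u w ≡ true) → count S ≤ Cmax G
joined-≤Cmax G P S P≥2 joined with two-members P P≥2
... | u , v , u≢v , Pu , Pv = shared-≤Cmax G S u v u≢v (λ w Sw → joined u w Pu Sw , joined v w Pv Sw)

IrregularWithCommon : ℕ → Graph → Set
IrregularWithCommon d G = (¬ Regular G) × (d ∸ 1 ≤ Cmax G)

absurd-bool : ∀ {A : Set} {b} → b ≡ true → b ≡ false → A
absurd-bool refl ()

drop-two : ∀ {d t} → suc d ≤ t + 2 → d ∸ 1 ≤ t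
drop-two {d} {t} h = ≤-trans (∸-monoˡ-≤ 2 h) (≤-reflexive (m+n∸n≡m t 2))

at-least : ∀ {m} (p : Fin m → Bool) {j k} → count p ≡ k → j ≤ k → j ≤ count p
at-least p |p| j≤k = ≤-trans j≤k (≤-reflexive (sym |p|))

pred-below : ∀ {d l} → d < l → d ∸ 1 ≤ l
pred-below {d} d<l = ≤-trans (m∸n≤m d 1) (≤-trans (n≤1+n d) d<l)

joined-common : (G : Graph) (P S : Fin (n G) → Bool) {d : ℕ} → d < count S → 2 ≤ count P →
  (∀ u w → P u ≡ true → S w ≡ true → adj G u w ≡ true) → d ∸ 1 ≤ Cmax G
joined-common G P S d<|S| P≥2 joined = ≤-trans (pred-below d<|S|) (joined-≤Cmax G P S P≥2 joined)

-- Γ₁ = H_d ∨ K̄_l: a vertex of C has its d neighbours in A, and A is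
-- completely joined to C.
type1 : ∀ d l G → 3 ≤ d → d < l → IsΓ₁ d l G → IrregularWithCommon d G
type1 d l G d≥3 d<l (inA , |A| , |C| , C-indep , A-C-joined) =
  joined-irregular G inA inC (at-least inA |A| (≤-trans (s≤s z≤n) d≥3)) joined deg-C C>d ,
  joined-common G inA inC C>d (at-least inA |A| (≤-trans (s≤s (s≤s z≤n)) d≥3)) joined
  where
  inC : Fin (n G) → Bool
  inC v = not (inA v)
  C>d : d < count inC
  C>d = at-least inC |C| d<l
  joined : ∀ u w → inA u ≡ true → inC w ≡ true → adj G u w ≡ true
  joined u w u∈A w∈C = A-C-joined u w u∈A (not-injective w∈C)
  deg-C : ∀ c → inC c ≡ true → deg G c ≤ d
  deg-C c c∈C = ≤-trans (deg-≤ G inA c nbr-in-A) (≤-reflexive |A|)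
    where
    nbr-in-A : ∀ w → adj G c w ≡ true → inA w ≡ true
    nbr-in-A w cw with inA w in e
    ... | true  = refl
    ... | false = absurd-bool cw (C-indep c w (not-injective c∈C) e)

a₂-label : ∀ x → isA₂ x ≡ true → x ≡ a₂
a₂-label a₂ _ = refl

c₂-label : ∀ x → isC₂ x ≡ true → x ≡ c₂
c₂-label c₂ _ = refl

-- Γ₂: a vertex of C has its neighbours in A plus one vertex of B, so
-- degree ≤ (d − 1) + 1; A is completely joined to C.
type2 : ∀ d l G → 3 ≤ d → d < l → IsΓ₂ d l G → IrregularWithCommon d G
type2 d l G d≥3 d<l (lab , |A| , _ , |C| , _ , A-C-joined , C-indep , one-B-nbr) =
  joined-irregular G inA inC (at-least inA |A| (∸-monoˡ-≤ 1 (≤-trans (s≤s (s≤s z≤n)) d≥3))) joined deg-C C>d ,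
  joined-common G inA inC C>d (at-least inA |A| (∸-monoˡ-≤ 1 d≥3)) joined
  where
  open ≤-Reasoning
  inA inB inC : Fin (n G) → Bool
  inA v = isA₂ (lab v)
  inB v = isB₂ (lab v)
  inC v = isC₂ (lab v)
  C>d : d < count inC
  C>d = at-least inC |C| d<l
  joined : ∀ u w → inA u ≡ true → inC w ≡ true → adj G u w ≡ true
  joined u w u∈A w∈C = A-C-joined u w (a₂-label (lab u) u∈A) (c₂-label (lab w) w∈C)
  deg-C : ∀ c → inC c ≡ true → deg G c ≤ d
  deg-C c c∈C = begin
    deg G c                                        ≤⟨ deg-≤ G (λ w → inA w ∨ B-nbr w) c nbr-in-A∪B ⟩
    count (λ w → inA w ∨ B-nbr w)                  ≤⟨ count-∨ inA B-nbr ⟩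
    count inA + count B-nbr                        ≡⟨ cong₂ _+_ |A| (one-B-nbr c lab-c) ⟩
    d ∸ 1 + 1                                      ≡⟨ m∸n+n≡m (≤-trans (s≤s z≤n) d≥3) ⟩
    d                                              ∎
    where
    lab-c : lab c ≡ c₂
    lab-c = c₂-label (lab c) c∈C
    B-nbr : Fin (n G) → Bool
    B-nbr w = inB w ∧ adj G c w
    nbr-in-A∪B : ∀ w → adj G c w ≡ true → (inA w ∨ B-nbr w) ≡ true
    nbr-in-A∪B w cw with lab w in e
    ... | a₂ = refl
    ... | b₂ = cw
    ... | c₂ = absurd-bool cw (C-indep c w lab-c e)

a₃-label : ∀ x → isA₃ x ≡ true → x ≡ a₃
a₃-label a₃ _ = refl

b₃-label : ∀ x → isB₃ x ≡ true → x ≡ b₃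
b₃-label b₃ _ = refl

c₃-label : ∀ x → isC₃ x ≡ true → x ≡ c₃
c₃-label c₃ _ = refl

-- Γ₃: a vertex of C has its neighbours in A plus one vertex of each of
-- B and B', so degree ≤ (d − 2) + 2; A is completely joined to C.  If
-- d ≥ 4 two vertices of A share C.  If d = 3, A = {a} and, as every
-- vertex of C has exactly one neighbour in B, some b ∈ B shares at least
-- l/2 ≥ 2 neighbours with a.
type3 : ∀ d l G → 3 ≤ d → d < l → IsΓ₃ d l G → IrregularWithCommon d G
type3 d l G d≥3 d<l (lab , |A| , |B| , _ , |C| , A-C-joined , C-indep , one-B-nbr , one-B'-nbr) =
  joined-irregular G inA inC A≥1 joined deg-C (at-least inC |C| d<l) ,
  common d d≥3 |A| d<l
  where
  open ≤-Reasoning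
  inA inB inB' inC : Fin (n G) → Bool
  inA v = isA₃ (lab v)
  inB v = isB₃ (lab v)
  inB' v = isB'₃ (lab v)
  inC v = isC₃ (lab v)
  A≥1 : 1 ≤ count inA
  A≥1 = at-least inA |A| (∸-monoˡ-≤ 2 d≥3)
  joined : ∀ u w → inA u ≡ true → inC w ≡ true → adj G u w ≡ true
  joined u w u∈A w∈C = A-C-joined u w (a₃-label (lab u) u∈A) (c₃-label (lab w) w∈C)
  deg-C : ∀ c → inC c ≡ true → deg G c ≤ d
  deg-C c c∈C = begin
    deg G c                                          ≤⟨ deg-≤ G (λ w → inA w ∨ (B-nbr w ∨ B'-nbr w)) c nbr-in-A∪B∪B' ⟩
    count (λ w → inA w ∨ (B-nbr w ∨ B'-nbr w))      ≤⟨ count-∨ inA (λ w → B-nbr w ∨ B'-nbr w) ⟩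
    count inA + count (λ w → B-nbr w ∨ B'-nbr w)    ≤⟨ +-monoʳ-≤ (count inA) (count-∨ B-nbr B'-nbr) ⟩
    count inA + (count B-nbr + count B'-nbr)         ≡⟨ cong₂ _+_ |A| (cong₂ _+_ (one-B-nbr c lab-c) (one-B'-nbr c lab-c)) ⟩
    d ∸ 2 + 2                                        ≡⟨ m∸n+n≡m (≤-trans (s≤s (s≤s z≤n)) d≥3) ⟩
    d                                                ∎
    where
    lab-c : lab c ≡ c₃
    lab-c = c₃-label (lab c) c∈C
    B-nbr B'-nbr : Fin (n G) → Bool
    B-nbr w = inB w ∧ adj G c w
    B'-nbr w = inB' w ∧ adj G c w
    nbr-in-A∪B∪B' : ∀ w → adj G c w ≡ true → (inA w ∨ (B-nbr w ∨ B'-nbr w)) ≡ true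
    nbr-in-A∪B∪B' w cw with lab w in e
    ... | a₃  = refl
    ... | b₃  = cong (_∨ false) cw
    ... | b'₃ = cw
    ... | c₃  = absurd-bool cw (C-indep c w lab-c e)
  B-share : ∀ b → inB b ≡ true → count (λ v → inC v ∧ adj G b v) ≤ Cmax G
  B-share b b∈B with member inA A≥1
  ... | a , a∈A = shared-≤Cmax G (λ v → inC v ∧ adj G b v) a b a≢b
                    (λ w w∈N → joined a w a∈A (∧-conicalˡ (inC w) _ w∈N) , ∧-conicalʳ (inC w) _ w∈N)
    where
    a≢b : a ≢ b
    a≢b a≡b with trans (sym (a₃-label (lab a) a∈A)) (trans (cong lab a≡b) (b₃-label (lab b) b∈B))
    ... | ()
  C≤2Cmax : count inC ≤ 2 * Cmax G
  C≤2Cmax = begin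
    count inC                                            ≡⟨⟩
    sumOver inC (λ _ → 1)                                ≤⟨ sumOver-mono inC (λ c c∈C →
                                                              ≤-reflexive (sym (one-B-nbr c (c₃-label (lab c) c∈C)))) ⟩
    sumOver inC (λ c → count (λ w → inB w ∧ adj G c w)) ≡⟨ double-count inC inB (adj G) (adj-sym G) ⟩
    sumOver inB (λ b → count (λ v → inC v ∧ adj G b v)) ≤⟨ sumOver-≤ inB _ (Cmax G) B-share ⟩
    count inB * Cmax G                                   ≡⟨ cong (_* Cmax G) |B| ⟩
    2 * Cmax G                                           ∎
  -- d = 3 by double counting through B, d ≥ 4 through two vertices of A.
  common : ∀ d → 3 ≤ d → count inA ≡ d ∸ 2 → d < l → d ∸ 1 ≤ Cmax G
  common 3 _ _ 3<l = *-cancelˡ-≤ 2 (≤-trans 3<l (≤-trans (≤-reflexive (sym |C|)) C≤2Cmax))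
  common (suc (suc (suc (suc _)))) _ |A| d<l =
    joined-common G inA inC (at-least inC |C| d<l) (at-least inA |A| (s≤s (s≤s z≤n))) joined
  common 0 () _ _
  common 1 (s≤s ()) _ _
  common 2 (s≤s (s≤s ())) _ _

a₄-label : ∀ x → isA₄ x ≡ true → x ≡ a₄
a₄-label a₄ _ = refl

c₄-label : ∀ x → isC₄ x ≡ true → x ≡ c₄
c₄-label c₄ _ = refl

u₄-label : ∀ x → isU₄ x ≡ true → x ≡ u₄
u₄-label u₄ _ = refl

-- Γ₄: a vertex of C ∖ U has its d neighbours in A.  At most two A–U edges
-- were deleted and |A| = d ≥ 3, so some a ∈ A is adjacent to all of U,
-- hence to all l vertices of C.  Two vertices of A share C ∖ U, which has
-- l − 2 ≥ d − 1 vertices.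
type4 : ∀ d l G → 3 ≤ d → d < l → IsΓ₄ d l G → IrregularWithCommon d G
type4 d l G d≥3 d<l (lab , |A| , |C∪U| , |U| , _ , C-indep , A-C-joined , U-loses≤1) =
  irregular G c a (≤-trans (s≤s deg-c) (≤-trans d<l deg-a)) ,
  ≤-trans C-large (joined-≤Cmax G inA inC (at-least inA |A| (≤-trans (s≤s (s≤s z≤n)) d≥3)) joined)
  where
  open ≤-Reasoning
  inA inC inU inC∪U : Fin (n G) → Bool
  inA v = isA₄ (lab v)
  inC v = isC₄ (lab v)
  inU v = isU₄ (lab v)
  inC∪U v = isCU₄ (lab v)
  joined : ∀ u w → inA u ≡ true → inC w ≡ true → adj G u w ≡ true
  joined u w u∈A w∈C = A-C-joined u w (a₄-label (lab u) u∈A) (c₄-label (lab w) w∈C)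
  C-large : d ∸ 1 ≤ count inC
  C-large = drop-two (begin
    suc d                    ≤⟨ d<l ⟩
    l                        ≡⟨ sym |C∪U| ⟩
    count inC∪U              ≤⟨ count-mono (λ w → split (lab w)) ⟩
    count (λ w → inC w ∨ inU w) ≤⟨ count-∨ inC inU ⟩
    count inC + count inU    ≡⟨ cong (count inC +_) |U| ⟩
    count inC + 2            ∎)
    where
    split : ∀ x → isCU₄ x ≡ true → (isC₄ x ∨ isU₄ x) ≡ true
    split c₄ _ = refl
    split u₄ _ = refl
  some-c : ∃[ c ] inC c ≡ true
  some-c = member inC (≤-trans (∸-monoˡ-≤ 1 (≤-trans (s≤s (s≤s z≤n)) d≥3)) C-large)
  c : Fin (n G)
  c = proj₁ some-c
  lab-c : lab c ≡ c₄
  lab-c = c₄-label (lab c) (proj₂ some-c)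
  deg-c : deg G c ≤ d
  deg-c = ≤-trans (deg-≤ G inA c nbr-in-A) (≤-reflexive |A|)
    where
    nbr-in-A : ∀ w → adj G c w ≡ true → inA w ≡ true
    nbr-in-A w cw with lab w in e
    ... | a₄ = refl
    ... | c₄ = absurd-bool cw (C-indep c w lab-c (cong isCU₄ e))
    ... | u₄ = absurd-bool cw (C-indep c w lab-c (cong isCU₄ e))
  missing-U : Fin (n G) → ℕ
  missing-U v = count (λ w → inU w ∧ not (adj G v w))
  few-missing : sumOver inA missing-U < count inA
  few-missing = begin-strict
    sumOver inA missing-U
      ≡⟨ double-count inA inU (λ v w → not (adj G v w)) (λ v w → cong not (adj-sym G v w)) ⟩
    sumOver inU (λ u → count (λ v → inA v ∧ not (adj G u v)))
      ≤⟨ sumOver-≤ inU _ 1 (λ u u∈U → U-loses≤1 u (u₄-label (lab u) u∈U)) ⟩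
    count inU * 1  ≡⟨ cong (_* 1) |U| ⟩
    2              <⟨ d≥3 ⟩
    d              ≡⟨ sym |A| ⟩
    count inA      ∎
  some-a : ∃[ a ] inA a ≡ true × missing-U a ≡ 0
  some-a = vanishing-term inA missing-U few-missing
  a : Fin (n G)
  a = proj₁ some-a
  lab-a : lab a ≡ a₄
  lab-a = a₄-label (lab a) (proj₁ (proj₂ some-a))
  deg-a : l ≤ deg G a
  deg-a = ≤-trans (≤-reflexive (sym |C∪U|)) (deg-≥ G inC∪U a nbr-of-a)
    where
    nbr-of-a : ∀ w → inC∪U w ≡ true → adj G a w ≡ true
    nbr-of-a w w∈C∪U with lab w in e
    ... | c₄ = A-C-joined a w lab-a e
    ... | u₄ = ∧-not-false (cong isU₄ e)
                 (count-zero (λ w → inU w ∧ not (adj G a w)) (proj₂ (proj₂ some-a)) w)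

-- Γ₅: each vertex of C misses at most one of the d + 1 vertices of A, so
-- two vertices of C share at least d − 1 of them.  In a k-regular Γ₅,
-- double counting the A–C edges gives l·k ≤ (d + 1)·k with k ≥ d > 0,
-- contradicting l ≥ d + 2.
type5 : ∀ d l G → 3 ≤ d → suc d < l → IsΓ₅ d l G → IrregularWithCommon d G
type5 d l G d≥3 d+1<l (inA , |A| , |C| , C-indep , A-degree) = not-regular , common
  where
  open ≤-Reasoning
  inC : Fin (n G) → Bool
  inC v = not (inA v)
  A-nbrs missing : Fin (n G) → ℕ
  A-nbrs c = count (λ w → inA w ∧ adj G c w)
  missing c = count (λ w → inA w ∧ not (adj G c w))
  A-nbrs≥d : ∀ c → inC c ≡ true → d ≤ A-nbrs c
  A-nbrs≥d c c∈C with A-degree c (not-injective c∈C)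
  ... | inj₁ ≡d   = ≤-reflexive (sym ≡d)
  ... | inj₂ ≡d+1 = ≤-trans (n≤1+n d) (≤-reflexive (sym ≡d+1))
  missing≤1 : ∀ c → inC c ≡ true → missing c ≤ 1
  missing≤1 c c∈C = +-cancelˡ-≤ d (missing c) 1 (begin
    d + missing c            ≤⟨ +-monoˡ-≤ (missing c) (A-nbrs≥d c c∈C) ⟩
    A-nbrs c + missing c     ≡⟨ sym (count-partition inA (adj G c)) ⟩
    count inA                ≡⟨ |A| ⟩
    suc d                    ≡⟨ +-comm 1 d ⟩
    d + 1                    ∎)
  deg-C : ∀ c → inC c ≡ true → deg G c ≤ A-nbrs c
  deg-C c c∈C = deg-≤ G (λ w → inA w ∧ adj G c w) c nbr-in-A
    where
    nbr-in-A : ∀ w → adj G c w ≡ true → (inA w ∧ adj G c w) ≡ true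
    nbr-in-A w cw with inA w in e
    ... | true  = cw
    ... | false = absurd-bool cw (C-indep c w (not-injective c∈C) e)
  common : d ∸ 1 ≤ Cmax G
  common with two-members inC (at-least inC |C| (≤-trans (s≤s (s≤s z≤n)) d+1<l))
  ... | u , v , u≢v , u∈C , v∈C = drop-two (begin
    suc d                                       ≡⟨ sym |A| ⟩
    count inA                                   ≤⟨ count-mono (λ w → cover w) ⟩
    count (λ w → shared w ∨ (miss₁ w ∨ miss₂ w)) ≤⟨ count-∨ shared (λ w → miss₁ w ∨ miss₂ w) ⟩
    count shared + count (λ w → miss₁ w ∨ miss₂ w)
                                                ≤⟨ +-monoʳ-≤ (count shared) (≤-trans (count-∨ miss₁ miss₂)
                                                     (+-mono-≤ (missing≤1 u u∈C) (missing≤1 v v∈C))) ⟩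
    count shared + 2                            ≤⟨ +-monoˡ-≤ 2 shared≤Cmax ⟩
    Cmax G + 2                                  ∎)
    where
    shared miss₁ miss₂ : Fin (n G) → Bool
    shared w = inA w ∧ (adj G u w ∧ adj G v w)
    miss₁ w = inA w ∧ not (adj G u w)
    miss₂ w = inA w ∧ not (adj G v w)
    cover : ∀ w → inA w ≡ true → (shared w ∨ (miss₁ w ∨ miss₂ w)) ≡ true
    cover w w∈A rewrite w∈A with adj G u w | adj G v w
    ... | true  | true  = refl
    ... | true  | false = refl
    ... | false | _     = refl
    shared≤Cmax : count shared ≤ Cmax G
    shared≤Cmax = shared-≤Cmax G shared u v u≢v (λ w w∈S →
      let both = ∧-conicalʳ (inA w) _ w∈S in ∧-conicalˡ (adj G u w) _ both , ∧-conicalʳ (adj G u w) _ both)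
  not-regular : ¬ Regular G
  not-regular (k , deg≡k) = <-irrefl refl (≤-trans d+1<l l≤d+1)
    where
    some-c : ∃[ c ] inC c ≡ true
    some-c = member inC (at-least inC |C| (≤-trans (s≤s z≤n) d+1<l))
    k≥d : d ≤ k
    k≥d = ≤-trans (A-nbrs≥d _ (proj₂ some-c))
            (≤-trans (count-mono (λ w → ∧-conicalʳ (inA w) _)) (≤-reflexive (deg≡k (proj₁ some-c))))
    edges : l * k ≤ suc d * k
    edges = begin
      l * k                                              ≡⟨ cong (_* k) (sym |C|) ⟩
      count inC * k                                      ≤⟨ sumOver-≥ inC (deg G) k (λ v _ → ≤-reflexive (sym (deg≡k v))) ⟩
      sumOver inC (deg G)                                ≤⟨ sumOver-mono inC deg-C ⟩
      sumOver inC A-nbrs                                 ≡⟨ double-count inC inA (adj G) (adj-sym G) ⟩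
      sumOver inA (λ a → count (λ v → inC v ∧ adj G a v)) ≤⟨ sumOver-mono inA (λ a _ → count-mono (λ v → ∧-conicalʳ (inC v) _)) ⟩
      sumOver inA (deg G)                                ≤⟨ sumOver-≤ inA (deg G) k (λ v _ → ≤-reflexive (deg≡k v)) ⟩
      count inA * k                                      ≡⟨ cong (_* k) |A| ⟩
      suc d * k                                          ∎
    l≤d+1 : l ≤ suc d
    l≤d+1 = *-cancelʳ-≤ l (suc d) k {{>-nonZero (≤-trans (≤-trans (s≤s z≤n) d≥3) k≥d)}} edges

lemma4p1 : (d : ℕ) → 3 ≤ d → (G : Graph) → InF d G →
    (¬ Regular G) × (d ∸ 1 ≤ Cmax G)
lemma4p1 d d≥3 G (l , inj₁ (d<l , Γ₁))                        = type1 d l G d≥3 d<l Γ₁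
lemma4p1 d d≥3 G (l , inj₂ (inj₁ (d<l , Γ₂)))                 = type2 d l G d≥3 d<l Γ₂
lemma4p1 d d≥3 G (l , inj₂ (inj₂ (inj₁ (d<l , Γ₃))))          = type3 d l G d≥3 d<l Γ₃
lemma4p1 d d≥3 G (l , inj₂ (inj₂ (inj₂ (inj₁ (d<l , Γ₄)))))   = type4 d l G d≥3 d<l Γ₄
lemma4p1 d d≥3 G (l , inj₂ (inj₂ (inj₂ (inj₂ (d+1<l , Γ₅))))) = type5 d l G d≥3 d+1<l Γ₅
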